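{- Let $X=\{v_1,\dots,v_k\}$ be a set of $k$ vertices, where each $v_i$ is assigned a set $X_{v_i}\subseteq\mathbb{N}$ with $|X_{v_i}|\le x$. Then for all $R'\subseteq R\subseteq\mathbb{N}^k$: if $R'$ $k$-$x$-represents $R$, then $R'$ $\mathcal{C}_X$-represents $R$.
   Context: For positive integers $k,q$, $a\in\mathbb{N}^k$ is $k$-$q$-compatible with $b\in\binom{\mathbb{N}}{q}^k$ if $a[i]\notin b[i]$ for all $i\in[k]$; $R'\subseteq R\subseteq\mathbb{N}^k$ $k$-$q$-represents $R$ if for every $b\in\binom{\mathbb{N}}{q}^k$, some $a\in R$ is $k$-$q$-compatible with $b$ iff some $a'\in R'$ is. The compatibility graph $\mathcal{C}_X$ is the bipartite graph with both sides equal to (copies of) $\mathbb{N}^k$, where $(i_1,\dots,i_k)$ on the left is adjacent to $(j_1,\dots,j_k)$ on the right iff $i_\ell+j_\ell\notin X_{v_\ell}$ for all $\ell\in[k]$. For a bipartite graph $H$ with sides $U,V$ and $R'\subseteq R\subseteq U$, $R'$ $H$-represents $R$ if for every $b\in V$: some $a\in R$ is adjacent to $b$ in $H$ iff some $a'\in R'$ is adjacent to $b$ in $H$. -}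

module Defs where

open import Data.Nat using (ℕ; _+_; _≤_)
open import Data.Fin using (Fin)
open import Data.List using (List; length)
open import Data.List.Membership.Propositional using (_∈_)
open import Data.List.Relation.Unary.Unique.Propositional using (Unique)
open import Data.Product using (Σ; _×_; ∃)
open import Relation.Nullary using (¬_)
open import Relation.Unary using (Pred; _⊆_)
open import Relation.Binary.PropositionalEquality using (_≡_)
open import Level using (0ℓ)
open import Function.Bundles using (_⇔_)

Vecℕ : ℕ → Set
Vecℕ k = Fin k → ℕ

record SmallSet (x : ℕ) : Set where
  field
    elems  : List ℕ
    unique : Unique elems
    size≤  : length elems ≤ x
open SmallSet public

-- An element of binom(ℕ, q): a q-element subset of ℕ (duplicate-free list of length q).
record QSubset (q : ℕ) : Set where
  field
    members : List ℕ
    uniqueQ : Unique members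
    sizeQ   : length members ≡ q
open QSubset public

Compatible : (k q : ℕ) → Vecℕ k → (Fin k → QSubset q) → Set
Compatible k q a b = ∀ i → ¬ (a i ∈ members (b i))

-- R' k-q-represents R (assuming R' ⊆ R, stated separately).
KQRepresents : (k q : ℕ) → Pred (Vecℕ k) 0ℓ → Pred (Vecℕ k) 0ℓ → Set
KQRepresents k q R' R =
  (b : Fin k → QSubset q) →
  (Σ (Vecℕ k) (λ a → R a × Compatible k q a b)) ⇔
  (Σ (Vecℕ k) (λ a' → R' a' × Compatible k q a' b))

-- Adjacency in the compatibility graph C_X: left i adjacent to right j
-- iff i_l + j_l ∉ X_{v_l} for all l.
CAdj : {k x : ℕ} → (Fin k → SmallSet x) → Vecℕ k → Vecℕ k → Set
CAdj X i j = ∀ l → ¬ ((i l + j l) ∈ elems (X l))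

CRepresents : {k x : ℕ} → (Fin k → SmallSet x) →
              Pred (Vecℕ k) 0ℓ → Pred (Vecℕ k) 0ℓ → Set
CRepresents {k} X R' R =
  (b : Vecℕ k) →
  (Σ (Vecℕ k) (λ a → R a × CAdj X a b)) ⇔
  (Σ (Vecℕ k) (λ a' → R' a' × CAdj X a' b))

{-# OPTIONS --safe #-}
-- Fix a right vertex b and an a ∈ R adjacent to b in C_X. For each coordinate i the set
-- X_i − b_i = {v : v + b_i ∈ X_i} has at most x elements and misses a_i; padding it with
-- fresh numbers gives an x-set B_i ⊇ X_i − b_i that still misses a_i. So a is compatible
-- with B, the representation yields a' ∈ R' compatible with B, and a'_i ∉ B_i forces
-- a'_i + b_i ∉ X_i. The converse direction is immediate from R' ⊆ R.
module Submission where

open import Defs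
open import Data.Nat using (ℕ; zero; suc; _+_; _∸_; _≤_; _≤?_; s≤s; z≤n)
open import Data.Nat.Properties
open import Data.Nat.ListAction using (sum)
open import Data.Fin using (Fin)
open import Data.List using (List; []; _∷_; length)
open import Data.List.Membership.Propositional using (_∈_; _∉_)
open import Data.List.Relation.Binary.Subset.Propositional using () renaming (_⊆_ to _⊆ₗ_)
open import Data.List.Relation.Unary.Any using (here; there)
open import Data.List.Relation.Unary.All.Properties using (¬Any⇒All¬; All¬⇒¬Any)
open import Data.List.Relation.Unary.AllPairs using ([]; _∷_)
open import Data.List.Relation.Unary.Unique.Propositional using (Unique)
open import Data.Product using (Σ; _×_; _,_; proj₁; proj₂)
open import Relation.Nullary using (yes; no)
open import Data.Empty using (⊥-elim)
open import Relation.Unary using (Pred; _⊆_)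
open import Relation.Binary.PropositionalEquality using (_≡_; refl; sym; trans; subst)
open import Function.Bundles using (mk⇔; module Equivalence)
open import Level using (0ℓ)

shiftDown : ℕ → List ℕ → List ℕ
shiftDown c [] = []
shiftDown c (s ∷ ss) with c ≤? s
... | yes _ = s ∸ c ∷ shiftDown c ss
... | no _  = shiftDown c ss

∈-shiftDown⁻ : ∀ c ss {v} → v ∈ shiftDown c ss → v + c ∈ ss
∈-shiftDown⁻ c (s ∷ ss) v∈ with c ≤? s
∈-shiftDown⁻ c (s ∷ ss) (here refl) | yes c≤s = here (m∸n+n≡m c≤s)
∈-shiftDown⁻ c (s ∷ ss) (there v∈) | yes _   = there (∈-shiftDown⁻ c ss v∈)
∈-shiftDown⁻ c (s ∷ ss) v∈         | no _    = there (∈-shiftDown⁻ c ss v∈)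

∈-shiftDown⁺ : ∀ c ss {v} → v + c ∈ ss → v ∈ shiftDown c ss
∈-shiftDown⁺ c (s ∷ ss) {v} v+c∈ with c ≤? s
∈-shiftDown⁺ c (s ∷ ss) {v} (here refl) | yes _ = here (sym (m+n∸n≡m v c))
∈-shiftDown⁺ c (s ∷ ss) {v} (here refl) | no c≰s = ⊥-elim (c≰s (m≤n+m c v))
∈-shiftDown⁺ c (s ∷ ss) (there v+c∈) | yes _ = there (∈-shiftDown⁺ c ss v+c∈)
∈-shiftDown⁺ c (s ∷ ss) (there v+c∈) | no _  = ∈-shiftDown⁺ c ss v+c∈

length-shiftDown : ∀ c ss → length (shiftDown c ss) ≤ length ss
length-shiftDown c [] = z≤n
length-shiftDown c (s ∷ ss) with c ≤? s
... | yes _ = s≤s (length-shiftDown c ss)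
... | no _  = m≤n⇒m≤1+n (length-shiftDown c ss)

unique-shiftDown : ∀ c {ss} → Unique ss → Unique (shiftDown c ss)
unique-shiftDown c {[]} [] = []
unique-shiftDown c {s ∷ ss} (s∉ss ∷ u) with c ≤? s
... | yes c≤s = ¬Any⇒All¬ (shiftDown c ss) s∸c∉ ∷ unique-shiftDown c u
  where
  s∸c∉ : s ∸ c ∉ shiftDown c ss
  s∸c∉ s∸c∈ = All¬⇒¬Any s∉ss (subst (_∈ ss) (m∸n+n≡m c≤s) (∈-shiftDown⁻ c ss s∸c∈))
... | no _ = unique-shiftDown c u

∈⇒≤sum : ∀ {n ns} → n ∈ ns → n ≤ sum ns
∈⇒≤sum {ns = n ∷ ns} (here refl) = m≤m+n n (sum ns)
∈⇒≤sum {ns = m ∷ ns} (there n∈ns) = ≤-trans (∈⇒≤sum n∈ns) (m≤n+m (sum ns) m)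

suc-sum∉ : ∀ ns → suc (sum ns) ∉ ns
suc-sum∉ ns s∈ = n≮n (sum ns) (∈⇒≤sum s∈)

padAvoiding : ∀ m {a T} → Unique T → a ∉ T →
  Σ (List ℕ) λ L → Unique L × length L ≡ m + length T × T ⊆ₗ L × a ∉ L
padAvoiding zero {T = T} u a∉T = T , u , refl , (λ v∈ → v∈) , a∉T
padAvoiding (suc m) {a} {T} u a∉T
  with padAvoiding m {a} {f ∷ T} (¬Any⇒All¬ T f∉T ∷ u) a∉fT
  where
  f = suc (sum (a ∷ T))
  f∉T : f ∉ T
  f∉T f∈T = suc-sum∉ (a ∷ T) (there f∈T)
  a∉fT : a ∉ f ∷ T
  a∉fT (here a≡f) = suc-sum∉ (a ∷ T) (here (sym a≡f))
  a∉fT (there a∈T) = a∉T a∈T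
... | L , uL , lenL , fT⊆L , a∉L =
  L , uL , trans lenL (+-suc m (length T)) , (λ v∈ → fT⊆L (there v∈)) , a∉L

qSubsetAvoiding : ∀ {q a T} → Unique T → length T ≤ q → a ∉ T →
  Σ (QSubset q) λ B → T ⊆ₗ members B × a ∉ members B
qSubsetAvoiding {q} {a} {T} u len≤ a∉T
  with padAvoiding (q ∸ length T) u a∉T
... | L , uL , lenL , T⊆L , a∉L =
  record { members = L ; uniqueQ = uL ; sizeQ = trans lenL (m∸n+n≡m len≤) } , T⊆L , a∉L

separatingQSubset : ∀ {x} (S : SmallSet x) c {a} → a + c ∉ elems S →
  Σ (QSubset x) λ B → a ∉ members B × (∀ {v} → v ∉ members B → v + c ∉ elems S)
separatingQSubset S c {a} a+c∉S
  with qSubsetAvoiding (unique-shiftDown c (unique S))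
         (≤-trans (length-shiftDown c (elems S)) (size≤ S))
         (λ a∈ → a+c∉S (∈-shiftDown⁻ c (elems S) a∈))
... | B , S-c⊆B , a∉B = B , a∉B , λ v∉B v+c∈S → v∉B (S-c⊆B (∈-shiftDown⁺ c (elems S) v+c∈S))

separatingFamily : ∀ {k x} (X : Fin k → SmallSet x) (b : Vecℕ k) {a} → CAdj X a b →
  Σ (Fin k → QSubset x) λ B → Compatible k x a B × (∀ a' → Compatible k x a' B → CAdj X a' b)
separatingFamily X b {a} adj =
  (λ i → proj₁ (sep i)) ,
  (λ i → proj₁ (proj₂ (sep i))) ,
  (λ a' comp i → proj₂ (proj₂ (sep i)) (comp i))
  where
  sep : ∀ i → Σ (QSubset _) λ B → a i ∉ members B × (∀ {v} → v ∉ members B → v + b i ∉ elems (X i))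
  sep i = separatingQSubset (X i) (b i) (adj i)

lemma3p3 : (k x : ℕ) → 1 ≤ k → 1 ≤ x →
    (X : Fin k → SmallSet x) →
    (R' R : Pred (Vecℕ k) 0ℓ) → R' ⊆ R →
    KQRepresents k x R' R → CRepresents X R' R
lemma3p3 k x _ _ X R' R R'⊆R rep b = mk⇔ to from
  where
  to : Σ (Vecℕ k) (λ a → R a × CAdj X a b) → Σ (Vecℕ k) (λ a' → R' a' × CAdj X a' b)
  to (a , a∈R , adj) with separatingFamily X b adj
  ... | B , comp , comp⇒adj with Equivalence.to (rep B) (a , a∈R , comp)
  ...   | a' , a'∈R' , comp' = a' , a'∈R' , comp⇒adj a' comp'

  from : Σ (Vecℕ k) (λ a' → R' a' × CAdj X a' b) → Σ (Vecℕ k) (λ a → R a × CAdj X a b)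
  from (a' , a'∈R' , adj) = a' , R'⊆R a'∈R' , adj
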